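{- Let $p_1,\dots,p_n$ ($n\ge3$) be points in convex and general position in the plane, labelled counterclockwise, indices taken modulo $n$. Let $Q\subset\mathbb{R}^{\binom n2}$ be the polytope given by $\sum_{i<j,\ i,j\in S}w^S_{ij}d_{ij}=1$ for every four-element $S\subseteq\{1,\dots,n\}$ (with $w^S_{ij}=1/(\det(p_i,p_j,p_k)\det(p_i,p_j,p_l))$, $\{k,l\}=S\setminus\{i,j\}$), $d_{ij}\le0$ for all pairs, and $d_{ij}=0$ for the convex hull edges. Let $T$ be a triangulation of $\{p_1,\dots,p_n\}$ and $d$ the vertex of $Q$ corresponding to $T$ (the point of $Q$ with $d_{ij}=0$ for every edge $ij$ of $T$). Then for every $i$, $$d_{i-1,i+1}=-\det(p_{i-1},p_i,p_{i+1})\bigl(\operatorname{Area}_T(p_i)-\det(p_{i-1},p_i,p_{i+1})\bigr).$$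
   Context: $\det(q_0,q_1,q_2)$ is the determinant with columns $(q_0,1),(q_1,1),(q_2,1)$ (positive for counterclockwise triples). A triangulation is a maximal non-crossing straight-line graph on the points. $\operatorname{Area}_T(p_i)=\sum_{l=1}^{t-1}\det(p_i,p_{j_l},p_{j_{l+1}})$ where $p_{j_1},\dots,p_{j_t}$ are the neighbours of $p_i$ in $T$ in angular order from $p_{j_1}=p_{i+1}$ to $p_{j_t}=p_{i-1}$, i.e. the total (normalized, $|\det|$) area of the triangles of $T$ incident to $p_i$. -}

module Defs where

open import Level using (0ℓ)
open import Data.Bool using (Bool; true; false; if_then_else_; _∧_; not)
open import Data.Nat as ℕ using (ℕ; zero; suc; _<ᵇ_; _≡ᵇ_)
open import Data.Nat.DivMod using (_%_; m%n<n)
open import Data.Fin using (Fin; toℕ; fromℕ<)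
open import Data.List using (List; []; _∷_; foldr; map; filter; upTo)
open import Data.Product using (_×_; _,_; proj₁; proj₂; ∃-syntax)
open import Data.Sum using (_⊎_)
open import Relation.Nullary using (¬_)
open import Relation.Binary.PropositionalEquality using (_≡_; _≢_)
open import Algebra.Structures using (IsCommutativeRing)
open import Relation.Binary.Structures using (IsStrictTotalOrder)

-- Ordered fields (the plane is F × F for an arbitrary ordered field F;
-- ℝ is one instance).  Equality is propositional equality.

record OrderedField : Set₁ where
  infixl 6 _+_ _-_
  infixl 7 _*_
  infix 4 _<_ _≤_
  field
    Carrier : Set
    _+_ _*_ : Carrier → Carrier → Carrier
    -_ : Carrier → Carrier
    0# 1# : Carrier
    _⁻¹ : Carrier → Carrier
    _<_ : Carrier → Carrier → Set
    isCommutativeRing : IsCommutativeRing _≡_ _+_ _*_ -_ 0# 1#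
    ⁻¹-inverse : ∀ x → x ≢ 0# → x * (x ⁻¹) ≡ 1#
    0≢1 : 0# ≢ 1#
    isStrictTotalOrder : IsStrictTotalOrder _≡_ _<_
    +-mono-< : ∀ {x y} z → x < y → x + z < y + z
    *-pos : ∀ {x y} → 0# < x → 0# < y → 0# < x * y

  _-_ : Carrier → Carrier → Carrier
  x - y = x + (- y)

  _≤_ : Carrier → Carrier → Set
  x ≤ y = x < y ⊎ x ≡ y

  sumL : List Carrier → Carrier
  sumL = foldr _+_ 0#

-- Cyclic indices on Fin n (labels 0..n-1 instead of 1..n).

shift : ∀ {n} → Fin n → ℕ → Fin n
shift {suc m} i k = fromℕ< (m%n<n (toℕ i ℕ.+ k) (suc m))

next : ∀ {n} → Fin n → Fin n
next i = shift i 1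

prev : ∀ {n} → Fin n → Fin n
prev {n} i = shift i (n ℕ.∸ 1)

-- reading a quantity indexed by unordered pairs {i,j}, stored at i<j
ord : ∀ {n} {A : Set} → (Fin n → Fin n → A) → Fin n → Fin n → A
ord f i j = if toℕ i <ᵇ toℕ j then f i j else f j i

module Geometry (F : OrderedField) where
  open OrderedField F

  Point : Set
  Point = Carrier × Carrier

  -- det of the 3x3 matrix with columns (q0,1),(q1,1),(q2,1)
  det : Point → Point → Point → Carrier
  det (x0 , y0) (x1 , y1) (x2 , y2) =
    (x1 - x0) * (y2 - y0) - (x2 - x0) * (y1 - y0)

  module Config {n : ℕ} (p : Fin n → Point) where

    Δ : Fin n → Fin n → Fin n → Carrier
    Δ i j k = det (p i) (p j) (p k)

    GeneralPosition : Set
    GeneralPosition = ∀ i j k → i ≢ j → j ≢ k → i ≢ k → Δ i j k ≢ 0#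

    -- convex position, labelled counterclockwise: every p_i p_{i+1} is a
    -- counterclockwise convex-hull edge, i.e. all other points lie strictly
    -- to its left
    ConvexCCW : Set
    ConvexCCW = ∀ i k → k ≢ i → k ≢ next i → 0# < Δ i (next i) k

    Cross : Fin n → Fin n → Fin n → Fin n → Set
    Cross a b c e = (Δ a b c * Δ a b e < 0#) × (Δ c e a * Δ c e b < 0#)

    -- a straight-line graph: edge set given by E i j for i < j
    Adj : (Fin n → Fin n → Bool) → Fin n → Fin n → Set
    Adj E i j = i ≢ j × ord E i j ≡ true

    adjᵇ : (Fin n → Fin n → Bool) → Fin n → Fin n → Bool
    adjᵇ E i j = ord E i j ∧ not (toℕ i ≡ᵇ toℕ j)

    Triangulation : (Fin n → Fin n → Bool) → Set
    Triangulation E =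
      (∀ a b c e → Adj E a b → Adj E c e → ¬ Cross a b c e) ×
      (∀ a b → a ≢ b → ¬ Adj E a b → ∃[ c ] ∃[ e ] (Adj E c e × Cross a b c e))

    -- neighbours of p_i in angular (= cyclic, by convexity) order, starting
    -- from p_{i+1} and ending at p_{i-1}
    neighbours : (Fin n → Fin n → Bool) → Fin n → List (Fin n)
    neighbours E i =
      filter (λ j → Relation.Nullary.Decidable.Core.T? (adjᵇ E i j))
             (map (λ k → shift i (suc k)) (upTo (n ℕ.∸ 1)))
      where import Relation.Nullary.Decidable.Core

    consecutiveSum : Fin n → List (Fin n) → Carrier
    consecutiveSum i [] = 0#
    consecutiveSum i (j ∷ []) = 0#
    consecutiveSum i (j ∷ k ∷ js) = Δ i j k + consecutiveSum i (k ∷ js)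

    Area : (Fin n → Fin n → Bool) → Fin n → Carrier
    Area E i = consecutiveSum i (neighbours E i)

    w : Fin n → Fin n → Fin n → Fin n → Carrier
    w i j k l = (Δ i j k * Δ i j l) ⁻¹

    InQ : (Fin n → Fin n → Carrier) → Set
    InQ d =
      (∀ a b c e → toℕ a ℕ.< toℕ b → toℕ b ℕ.< toℕ c → toℕ c ℕ.< toℕ e →
         w a b c e * ord d a b + w a c b e * ord d a c + w a e b c * ord d a e
       + w b c a e * ord d b c + w b e a c * ord d b e + w c e a b * ord d c e
       ≡ 1#) ×
      (∀ i j → i ≢ j → ord d i j ≤ 0#) ×
      (∀ i → ord d i (next i) ≡ 0#)

-- Write b = p_i and let p_{i+1} = x_0, x_1, …, x_t = p_{i-1} = a be the
-- neighbours of b in T in angular order. Besides the edges b x_k, T contains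
-- every x_k x_{k+1}: otherwise, by maximality, some edge of T crosses
-- x_k x_{k+1}, and in convex position such an edge ends in b or crosses b x_k
-- or b x_{k+1}. So for k < t - 1, d vanishes on four of the six pairs from
-- {b, x_k, x_{k+1}, a}, and the equation of Q for this set determines d(x_k, a)
-- from d(x_{k+1}, a).
-- Downward induction from d(x_{t-1}, a) = 0 gives
--   d(x_k, a) = -γ_k (A_k - γ_k),   γ_k = det(b, x_k, a),
-- where A_k is the area of the triangles of T at b between x_k and a; k = 0 is
-- the claim.

module Submission where

open import Defs
open import Data.Nat using (ℕ; _≤_)
open import Data.Fin using (Fin)
open import Data.Bool using (Bool)
open import Relation.Binary.PropositionalEquality using (_≡_)
open import Data.Nat using (suc; zero; s≤s)
open import Relation.Binary.PropositionalEquality using (cong; sym; module ≡-Reasoning)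
open import Algebra.Structures using (IsCommutativeRing)

-- The library solvers, instantiated with the elements of an abstract ring as
-- coefficients, cannot see that 1 - 1 = 0; integer coefficients can.
module CommutativeRingSolver
  {A : Set} {add mul : A → A → A} {neg : A → A} {zero one : A}
  (isCommutativeRing : IsCommutativeRing _≡_ add mul neg zero one) where

  open import Relation.Binary.PropositionalEquality
  open import Data.Maybe using (Maybe; just; nothing)
  open import Data.Product.Properties using (≡-dec)
  open import Relation.Nullary using (yes; no)
  open import Data.Nat as ℕ using (ℕ; suc; _∸_)
  open import Data.Product using (_×_; _,_)
  open import Algebra.Bundles using (CommutativeRing; RawRing)
  open import Algebra.Solver.Ring.AlmostCommutativeRing
    using (fromCommutativeRing; _-Raw-AlmostCommutative⟶_)

  private
    R : CommutativeRing _ _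
    R = record { isCommutativeRing = isCommutativeRing }

  open CommutativeRing R using (_+_; _*_; -_; _-_; 0#; 1#; +-assoc; +-comm; distribˡ; distribʳ; +-identityʳ; -‿inverseʳ)
  open import Algebra.Properties.Ring (CommutativeRing.ring R) using (-‿distribˡ-*; -‿distribʳ-*)
  open import Algebra.Properties.AbelianGroup (CommutativeRing.+-abelianGroup R) using (⁻¹-∙-comm; xyx⁻¹≈y)
  open import Algebra.Properties.Group (CommutativeRing.+-group R) using (⁻¹-involutive; ε⁻¹≈ε)
  open import Algebra.Properties.Semiring.Mult (CommutativeRing.semiring R)
    using (×-homo-+; ×1-homo-*) renaming (_×_ to _·_)
  open ≡-Reasoning

  -- Integer coefficients, as pairs (m , n) standing for m - n; normalising
  -- with `diff` makes equal integers syntactically equal, which the final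
  -- `refl` of the solver relies on.
  diff : ℕ → ℕ → ℕ × ℕ
  diff m n = m ∸ n , n ∸ m

  _+ℤ_ _*ℤ_ : ℕ × ℕ → ℕ × ℕ → ℕ × ℕ
  (a , b) +ℤ (c , d) = diff (a ℕ.+ c) (b ℕ.+ d)
  (a , b) *ℤ (c , d) = diff (a ℕ.* c ℕ.+ b ℕ.* d) (a ℕ.* d ℕ.+ b ℕ.* c)

  -ℤ_ : ℕ × ℕ → ℕ × ℕ
  -ℤ (a , b) = b , a

  ℤ-rawRing : RawRing _ _
  ℤ-rawRing = record
    { Carrier = ℕ × ℕ ; _≈_ = _≡_ ; _+_ = _+ℤ_ ; _*_ = _*ℤ_ ; -_ = -ℤ_ ; 0# = 0 , 0 ; 1# = 1 , 0 }

  private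
    ⟨_⟩ : ℕ × ℕ → A
    ⟨ m , n ⟩ = m · 1# - n · 1#

  -- 0 and 1 are interpreted as 0# and 1# on the nose, so that the constants
  -- in a stated identity are those of the ring.
  ⟦_⟧ℤ : ℕ × ℕ → A
  ⟦ 0 , 0 ⟧ℤ = 0#
  ⟦ 1 , 0 ⟧ℤ = 1#
  ⟦ x ⟧ℤ = ⟨ x ⟩

  private
    ⟦⟧ℤ≡⟨⟩ : ∀ x → ⟦ x ⟧ℤ ≡ ⟨ x ⟩
    ⟦⟧ℤ≡⟨⟩ (0 , 0) = sym (-‿inverseʳ 0#)
    ⟦⟧ℤ≡⟨⟩ (1 , 0) = sym (trans (cong₂ _+_ (+-identityʳ 1#) ε⁻¹≈ε) (+-identityʳ 1#))
    ⟦⟧ℤ≡⟨⟩ (0 , suc n) = refl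
    ⟦⟧ℤ≡⟨⟩ (1 , suc n) = refl
    ⟦⟧ℤ≡⟨⟩ (suc (suc m) , n) = refl

    x+y-[x+z]≡y-z : ∀ x y z → (x + y) - (x + z) ≡ y - z
    x+y-[x+z]≡y-z x y z = begin
      (x + y) + - (x + z)    ≡⟨ cong ((x + y) +_) (⁻¹-∙-comm x z) ⟨
      (x + y) + (- x + - z)  ≡⟨ +-assoc (x + y) (- x) (- z) ⟨
      (x + y) + - x + - z    ≡⟨ cong (_+ - z) (xyx⁻¹≈y x y) ⟩
      y + - z                ∎

    ⟨diff⟩ : ∀ m n → ⟨ diff m n ⟩ ≡ ⟨ m , n ⟩
    ⟨diff⟩ 0 0 = refl
    ⟨diff⟩ 0 (suc n) = refl
    ⟨diff⟩ (suc m) 0 = refl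
    ⟨diff⟩ (suc m) (suc n) = trans (⟨diff⟩ m n) (sym (x+y-[x+z]≡y-z 1# (m · 1#) (n · 1#)))

    -[x+y]≡-x-y : ∀ x y → - (x + y) ≡ - x + - y
    -[x+y]≡-x-y x y = sym (⁻¹-∙-comm x y)

    [a-b]+[c-d] : ∀ a b c d → (a + c) - (b + d) ≡ (a - b) + (c - d)
    [a-b]+[c-d] a b c d = begin
      (a + c) + - (b + d)     ≡⟨ cong ((a + c) +_) (-[x+y]≡-x-y b d) ⟩
      (a + c) + (- b + - d)   ≡⟨ +-assoc a c _ ⟩
      a + (c + (- b + - d))   ≡⟨ cong (a +_) (+-assoc c (- b) (- d)) ⟨
      a + ((c + - b) + - d)   ≡⟨ cong (λ t → a + (t + - d)) (+-comm c (- b)) ⟩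
      a + ((- b + c) + - d)   ≡⟨ cong (a +_) (+-assoc (- b) c (- d)) ⟩
      a + (- b + (c + - d))   ≡⟨ +-assoc a (- b) _ ⟨
      (a + - b) + (c + - d)   ∎

    [a-b][c-d] : ∀ a b c d → (a - b) * (c - d) ≡ (a * c + b * d) - (a * d + b * c)
    [a-b][c-d] a b c d = begin
      (a - b) * (c - d)                            ≡⟨ distribʳ (c - d) a (- b) ⟩
      a * (c - d) + - b * (c - d)                  ≡⟨ cong₂ _+_ (distribˡ a c (- d)) (distribˡ (- b) c (- d)) ⟩
      (a * c + a * - d) + (- b * c + - b * - d)    ≡⟨ cong₂ (λ s t → (a * c + s) + (t + - b * - d))
                                                        (-‿distribʳ-* a d) (-‿distribˡ-* b c) ⟨
      (a * c - a * d) + (- (b * c) + - b * - d)    ≡⟨ cong (λ t → (a * c - a * d) + (- (b * c) + t)) -b*-d ⟩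
      (a * c - a * d) + (- (b * c) + b * d)        ≡⟨ cong ((a * c - a * d) +_) (+-comm _ _) ⟩
      (a * c - a * d) + (b * d - b * c)            ≡⟨ [a-b]+[c-d] (a * c) (a * d) (b * d) (b * c) ⟨
      (a * c + b * d) - (a * d + b * c)            ∎
      where
      -b*-d : - b * - d ≡ b * d
      -b*-d = trans (sym (-‿distribˡ-* b (- d)))
                    (trans (cong -_ (sym (-‿distribʳ-* b d))) (⁻¹-involutive (b * d)))

    ⟨⟩-homo-+ : ∀ x y → ⟨ x +ℤ y ⟩ ≡ ⟨ x ⟩ + ⟨ y ⟩
    ⟨⟩-homo-+ (a , b) (c , d) = begin
      ⟨ diff (a ℕ.+ c) (b ℕ.+ d) ⟩               ≡⟨ ⟨diff⟩ (a ℕ.+ c) (b ℕ.+ d) ⟩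
      (a ℕ.+ c) · 1# - (b ℕ.+ d) · 1#            ≡⟨ cong₂ _-_ (×-homo-+ 1# a c) (×-homo-+ 1# b d) ⟩
      (a · 1# + c · 1#) - (b · 1# + d · 1#)      ≡⟨ [a-b]+[c-d] _ _ _ _ ⟩
      ⟨ a , b ⟩ + ⟨ c , d ⟩                      ∎

    ⟨⟩-homo-* : ∀ x y → ⟨ x *ℤ y ⟩ ≡ ⟨ x ⟩ * ⟨ y ⟩
    ⟨⟩-homo-* (a , b) (c , d) = begin
      ⟨ diff (a ℕ.* c ℕ.+ b ℕ.* d) (a ℕ.* d ℕ.+ b ℕ.* c) ⟩  ≡⟨ ⟨diff⟩ (a ℕ.* c ℕ.+ b ℕ.* d) (a ℕ.* d ℕ.+ b ℕ.* c) ⟩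
      (a ℕ.* c ℕ.+ b ℕ.* d) · 1# - (a ℕ.* d ℕ.+ b ℕ.* c) · 1#
        ≡⟨ cong₂ _-_ (trans (×-homo-+ 1# (a ℕ.* c) (b ℕ.* d)) (cong₂ _+_ (×1-homo-* a c) (×1-homo-* b d)))
                     (trans (×-homo-+ 1# (a ℕ.* d) (b ℕ.* c)) (cong₂ _+_ (×1-homo-* a d) (×1-homo-* b c))) ⟩
      (a · 1# * (c · 1#) + b · 1# * (d · 1#)) - (a · 1# * (d · 1#) + b · 1# * (c · 1#))
        ≡⟨ [a-b][c-d] _ _ _ _ ⟨
      ⟨ a , b ⟩ * ⟨ c , d ⟩                                ∎

    ⟨⟩-homo-- : ∀ x → ⟨ -ℤ x ⟩ ≡ - ⟨ x ⟩
    ⟨⟩-homo-- (a , b) = begin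
      b · 1# + - (a · 1#)        ≡⟨ +-comm _ _ ⟩
      - (a · 1#) + b · 1#        ≡⟨ cong (- (a · 1#) +_) (⁻¹-involutive _) ⟨
      - (a · 1#) + - - (b · 1#)  ≡⟨ -[x+y]≡-x-y _ _ ⟨
      - ⟨ a , b ⟩                ∎

    via⟨⟩ : ∀ (f : ℕ × ℕ → ℕ × ℕ → ℕ × ℕ) (g : A → A → A) →
            (∀ x y → ⟨ f x y ⟩ ≡ g ⟨ x ⟩ ⟨ y ⟩) → ∀ x y → ⟦ f x y ⟧ℤ ≡ g ⟦ x ⟧ℤ ⟦ y ⟧ℤ
    via⟨⟩ f g hom x y =
      trans (⟦⟧ℤ≡⟨⟩ (f x y)) (trans (hom x y) (sym (cong₂ g (⟦⟧ℤ≡⟨⟩ x) (⟦⟧ℤ≡⟨⟩ y))))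

    morphism : ℤ-rawRing -Raw-AlmostCommutative⟶ fromCommutativeRing R
    morphism = record
      { ⟦_⟧ = ⟦_⟧ℤ
      ; +-homo = via⟨⟩ _+ℤ_ _+_ ⟨⟩-homo-+
      ; *-homo = via⟨⟩ _*ℤ_ _*_ ⟨⟩-homo-*
      ; -‿homo = λ x → trans (⟦⟧ℤ≡⟨⟩ (-ℤ x)) (trans (⟨⟩-homo-- x) (cong -_ (sym (⟦⟧ℤ≡⟨⟩ x))))
      ; 0-homo = refl
      ; 1-homo = refl
      }

    _≟ℤ_ : ∀ x y → Maybe (⟦ x ⟧ℤ ≡ ⟦ y ⟧ℤ)
    x ≟ℤ y with ≡-dec ℕ._≟_ ℕ._≟_ x y
    ... | yes x≡y = just (cong ⟦_⟧ℤ x≡y)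
    ... | no _    = nothing

  open import Algebra.Solver.Ring ℤ-rawRing (fromCommutativeRing R) morphism _≟ℤ_ public
    using (Polynomial; solve; _:=_; con; _:+_; _:*_; :-_; _:-_)

  0̂ 1̂ : ∀ {n} → Polynomial n
  0̂ = con (0 , 0)
  1̂ = con (1 , 0)

module OrderedFieldProperties (F : OrderedField) where

  open import Data.Product using (_×_; _,_)
  open import Data.Empty using (⊥-elim)
  open import Data.Sum using (_⊎_; inj₁; inj₂)
  open import Relation.Nullary using (¬_)
  open import Relation.Binary.PropositionalEquality
  open import Relation.Binary.Definitions using (tri<; tri≈; tri>)
  open import Relation.Binary.Structures using (IsStrictTotalOrder)

  open OrderedField F
  open IsCommutativeRing isCommutativeRing using (+-comm; *-comm; zeroˡ; zeroʳ; +-identityˡ; -‿inverseˡ; -‿inverseʳ)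
  open IsStrictTotalOrder isStrictTotalOrder using (compare; irrefl; asym) renaming (trans to <-trans)
  open CommutativeRingSolver isCommutativeRing
  open ≡-Reasoning

  private
    <-irrefl : ∀ {x} → ¬ x < x
    <-irrefl = irrefl refl

  pos⇒neg-neg : ∀ {x} → 0# < x → - x < 0#
  pos⇒neg-neg {x} 0<x = subst₂ _<_ (+-identityˡ (- x)) (-‿inverseʳ x) (+-mono-< (- x) 0<x)

  neg⇒neg-pos : ∀ {x} → x < 0# → 0# < - x
  neg⇒neg-pos {x} x<0 = subst₂ _<_ (-‿inverseʳ x) (+-identityˡ (- x)) (+-mono-< (- x) x<0)

  pos*neg⇒neg : ∀ {x y} → 0# < x → y < 0# → x * y < 0#
  pos*neg⇒neg {x} {y} 0<x y<0 =
    subst (_< 0#) (solve 2 (λ x y → :- (x :* :- y) := x :* y) refl x y)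
          (pos⇒neg-neg (*-pos 0<x (neg⇒neg-pos y<0)))

  neg*pos⇒neg : ∀ {x y} → x < 0# → 0# < y → x * y < 0#
  neg*pos⇒neg {x} {y} x<0 0<y = subst (_< 0#) (*-comm y x) (pos*neg⇒neg 0<y x<0)

  neg*neg⇒pos : ∀ {x y} → x < 0# → y < 0# → 0# < x * y
  neg*neg⇒pos {x} {y} x<0 y<0 =
    subst (0# <_) (solve 2 (λ x y → :- x :* :- y := x :* y) refl x y)
          (*-pos (neg⇒neg-pos x<0) (neg⇒neg-pos y<0))

  *-neg⇒opposite-signs : ∀ {x y} → x * y < 0# → (x < 0# × 0# < y) ⊎ (0# < x × y < 0#)
  *-neg⇒opposite-signs {x} {y} xy<0 with compare x 0# | compare y 0#
  ... | tri< x<0 _ _  | tri< y<0 _ _  = ⊥-elim (asym (neg*neg⇒pos x<0 y<0) xy<0)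
  ... | tri< x<0 _ _  | tri> _ _ 0<y  = inj₁ (x<0 , 0<y)
  ... | tri> _ _ 0<x  | tri< y<0 _ _  = inj₂ (0<x , y<0)
  ... | tri> _ _ 0<x  | tri> _ _ 0<y  = ⊥-elim (asym (*-pos 0<x 0<y) xy<0)
  ... | tri≈ _ refl _ | _             = ⊥-elim (<-irrefl (subst (_< 0#) (zeroˡ y) xy<0))
  ... | _             | tri≈ _ refl _ = ⊥-elim (<-irrefl (subst (_< 0#) (zeroʳ x) xy<0))

  *-pos⇒posʳ : ∀ {x y} → 0# < x → 0# < x * y → 0# < y
  *-pos⇒posʳ {x} {y} 0<x 0<xy with compare y 0#
  ... | tri< y<0 _ _  = ⊥-elim (asym 0<xy (pos*neg⇒neg 0<x y<0))
  ... | tri≈ _ refl _ = ⊥-elim (<-irrefl (subst (0# <_) (zeroʳ x) 0<xy))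
  ... | tri> _ _ 0<y  = 0<y

  +-pos : ∀ {x y} → 0# < x → 0# < y → 0# < x + y
  +-pos {x} {y} 0<x 0<y = <-trans 0<x (subst₂ _<_ (+-identityˡ x) (+-comm y x) (+-mono-< x 0<y))

  *-cancelˡ-≡0 : ∀ {x y} → x ≢ 0# → x * y ≡ 0# → y ≡ 0#
  *-cancelˡ-≡0 {x} {y} x≢0 xy≡0 = begin
    y                                     ≡⟨ solve 3 (λ x y z → y := z :* (x :* y) :+ y :* (1̂ :- x :* z)) refl x y (x ⁻¹) ⟩
    x ⁻¹ * (x * y) + y * (1# - x * x ⁻¹)  ≡⟨ cong₂ (λ s t → x ⁻¹ * s + y * (1# - t)) xy≡0 (⁻¹-inverse x x≢0) ⟩
    x ⁻¹ * 0# + y * (1# - 1#)             ≡⟨ solve 2 (λ y z → z :* 0̂ :+ y :* (1̂ :- 1̂) := 0̂) refl y (x ⁻¹) ⟩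
    0#                                    ∎

  *-≢0 : ∀ {x y} → x ≢ 0# → y ≢ 0# → x * y ≢ 0#
  *-≢0 x≢0 y≢0 xy≡0 = y≢0 (*-cancelˡ-≡0 x≢0 xy≡0)

  -‿involutive : ∀ x → - - x ≡ x
  -‿involutive = solve 1 (λ x → :- (:- x) := x) refl

  -‿≢0 : ∀ {x} → x ≢ 0# → - x ≢ 0#
  -‿≢0 {x} x≢0 -x≡0 = x≢0 (begin
    x      ≡⟨ -‿involutive x ⟨
    - - x  ≡⟨ cong -_ -x≡0 ⟩
    - 0#   ≡⟨ solve 0 (:- 0̂ := 0̂) refl ⟩
    0#     ∎)

  x*[-x]⁻¹≡-1 : ∀ {x} → x ≢ 0# → x * (- x) ⁻¹ ≡ - 1#
  x*[-x]⁻¹≡-1 {x} x≢0 = begin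
    x * (- x) ⁻¹        ≡⟨ solve 2 (λ x z → x :* z := :- (:- x :* z)) refl x ((- x) ⁻¹) ⟩
    - (- x * (- x) ⁻¹)  ≡⟨ cong -_ (⁻¹-inverse (- x) (-‿≢0 x≢0)) ⟩
    - 1#                ∎

  x≡-y⇒x+y≡0 : ∀ {x y} → x ≡ - y → x + y ≡ 0#
  x≡-y⇒x+y≡0 {y = y} refl = -‿inverseˡ y

  x+y≡0⇒x≡-y : ∀ {x y} → x + y ≡ 0# → x ≡ - y
  x+y≡0⇒x≡-y {x} {y} x+y≡0 = begin
    x              ≡⟨ solve 2 (λ x y → x := (x :+ y) :- y) refl x y ⟩
    (x + y) - y    ≡⟨ cong (_- y) x+y≡0 ⟩
    0# - y         ≡⟨ +-identityˡ (- y) ⟩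
    - y            ∎

module DeterminantProperties (F : OrderedField) where

  open import Data.Product using (_×_; _,_)
  open import Relation.Binary.PropositionalEquality

  open OrderedField F
  open Geometry F using (det)
  open CommutativeRingSolver isCommutativeRing

  private
    det̂ : ∀ {k} → Polynomial k × Polynomial k → Polynomial k × Polynomial k →
          Polynomial k × Polynomial k → Polynomial k
    det̂ (x₀ , y₀) (x₁ , y₁) (x₂ , y₂) = (x₁ :- x₀) :* (y₂ :- y₀) :- (x₂ :- x₀) :* (y₁ :- y₀)

  det-cyclic : ∀ u v w → det u v w ≡ det v w u
  det-cyclic (a , b) (c , d) (e , f) =
    solve 6 (λ a b c d e f → det̂ (a , b) (c , d) (e , f) := det̂ (c , d) (e , f) (a , b)) refl a b c d e f

  det-swap : ∀ u v w → det u w v ≡ - det u v w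
  det-swap (a , b) (c , d) (e , f) =
    solve 6 (λ a b c d e f → det̂ (a , b) (e , f) (c , d) := :- det̂ (a , b) (c , d) (e , f)) refl a b c d e f

  det-repeat₁₃ : ∀ u v → det u v u ≡ 0#
  det-repeat₁₃ (a , b) (c , d) = solve 4 (λ a b c d → det̂ (a , b) (c , d) (a , b) := 0̂) refl a b c d

  det-repeat₂₃ : ∀ u v → det u v v ≡ 0#
  det-repeat₂₃ (a , b) (c , d) = solve 4 (λ a b c d → det̂ (a , b) (c , d) (c , d) := 0̂) refl a b c d

  det-expand : ∀ o u v w → det u v w ≡ det o v w - det o u w + det o u v
  det-expand (a , b) (c , d) (e , f) (g , h) =
    solve 8 (λ a b c d e f g h → let o = a , b; u = c , d; v = e , f; w = g , h in
      det̂ u v w := det̂ o v w :- det̂ o u w :+ det̂ o u v) refl a b c d e f g h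

  det-plücker : ∀ o s t u v → det o s t * det o u v ≡ det o s u * det o t v + det o s v * det o u t
  det-plücker (a , b) (c , d) (e , f) (g , h) (i , j) =
    solve 10 (λ a b c d e f g h i j → let o = a , b; s = c , d; t = e , f; u = g , h; v = i , j in
      det̂ o s t :* det̂ o u v := det̂ o s u :* det̂ o t v :+ det̂ o s v :* det̂ o u t) refl a b c d e f g h i j

module FourPointEquation (F : OrderedField) where

  open import Relation.Binary.PropositionalEquality

  open OrderedField F
  open IsCommutativeRing isCommutativeRing using (*-identityʳ)
  open OrderedFieldProperties F
  open CommutativeRingSolver isCommutativeRing
  open ≡-Reasoning

  -- The equation of Q for a four-element set, multiplied by l₁l₂l₃l₄ where
  -- (l₁, l₂, l₃, l₄) is the affine dependence of the four points: the weight
  -- of d_ij then becomes -lᵢlⱼ.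
  FourPointEq : (l₁ l₂ l₃ l₄ d₁₂ d₁₃ d₁₄ d₂₃ d₂₄ d₃₄ : Carrier) → Set
  FourPointEq l₁ l₂ l₃ l₄ d₁₂ d₁₃ d₁₄ d₂₃ d₂₄ d₃₄ =
    l₁ * l₂ * d₁₂ + l₁ * l₃ * d₁₃ + l₁ * l₄ * d₁₄ + l₂ * l₃ * d₂₃ + l₂ * l₄ * d₂₄ + l₃ * l₄ * d₃₄
      ≡ - (l₁ * l₂ * l₃ * l₄)

  weighted-term : ∀ x y d → y ≢ 0# → x * y * ((- y) ⁻¹ * d) ≡ - (x * d)
  weighted-term x y d y≢0 = begin
    x * y * ((- y) ⁻¹ * d)     ≡⟨ solve 4 (λ x y z d → x :* y :* (z :* d) := x :* (y :* z) :* d) refl x y ((- y) ⁻¹) d ⟩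
    x * (y * (- y) ⁻¹) * d     ≡⟨ cong (λ t → x * t * d) (x*[-x]⁻¹≡-1 y≢0) ⟩
    x * - 1# * d               ≡⟨ solve 2 (λ x d → x :* :- 1̂ :* d := :- (x :* d)) refl x d ⟩
    - (x * d)                  ∎

  weighted-sum-scaled :
    ∀ {l₁ l₂ l₃ l₄} d₁₂ d₁₃ d₁₄ d₂₃ d₂₄ d₃₄ → l₁ ≢ 0# → l₂ ≢ 0# → l₃ ≢ 0# → l₄ ≢ 0# →
    l₁ * l₂ * l₃ * l₄ * ((- (l₃ * l₄)) ⁻¹ * d₁₂ + (- (l₂ * l₄)) ⁻¹ * d₁₃ + (- (l₂ * l₃)) ⁻¹ * d₁₄
                         + (- (l₁ * l₄)) ⁻¹ * d₂₃ + (- (l₁ * l₃)) ⁻¹ * d₂₄ + (- (l₁ * l₂)) ⁻¹ * d₃₄)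
      ≡ - (l₁ * l₂ * d₁₂ + l₁ * l₃ * d₁₃ + l₁ * l₄ * d₁₄ + l₂ * l₃ * d₂₃ + l₂ * l₄ * d₂₄ + l₃ * l₄ * d₃₄)
  weighted-sum-scaled {l₁} {l₂} {l₃} {l₄} d₁₂ d₁₃ d₁₄ d₂₃ d₂₄ d₃₄ l₁≢0 l₂≢0 l₃≢0 l₄≢0 = begin
    l₁ * l₂ * l₃ * l₄ * (w₁₂ + w₁₃ + w₁₄ + w₂₃ + w₂₄ + w₃₄)
      ≡⟨ solve 10 (λ l₁ l₂ l₃ l₄ w₁₂ w₁₃ w₁₄ w₂₃ w₂₄ w₃₄ →
           l₁ :* l₂ :* l₃ :* l₄ :* (w₁₂ :+ w₁₃ :+ w₁₄ :+ w₂₃ :+ w₂₄ :+ w₃₄) :=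
           l₁ :* l₂ :* (l₃ :* l₄) :* w₁₂ :+ l₁ :* l₃ :* (l₂ :* l₄) :* w₁₃ :+ l₁ :* l₄ :* (l₂ :* l₃) :* w₁₄
             :+ l₂ :* l₃ :* (l₁ :* l₄) :* w₂₃ :+ l₂ :* l₄ :* (l₁ :* l₃) :* w₂₄ :+ l₃ :* l₄ :* (l₁ :* l₂) :* w₃₄)
           refl l₁ l₂ l₃ l₄ w₁₂ w₁₃ w₁₄ w₂₃ w₂₄ w₃₄ ⟩
    l₁ * l₂ * (l₃ * l₄) * w₁₂ + l₁ * l₃ * (l₂ * l₄) * w₁₃ + l₁ * l₄ * (l₂ * l₃) * w₁₄
      + l₂ * l₃ * (l₁ * l₄) * w₂₃ + l₂ * l₄ * (l₁ * l₃) * w₂₄ + l₃ * l₄ * (l₁ * l₂) * w₃₄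
      ≡⟨ cong₂ _+_ (cong₂ _+_ (cong₂ _+_ (cong₂ _+_ (cong₂ _+_
           (weighted-term (l₁ * l₂) (l₃ * l₄) d₁₂ (*-≢0 l₃≢0 l₄≢0))
           (weighted-term (l₁ * l₃) (l₂ * l₄) d₁₃ (*-≢0 l₂≢0 l₄≢0)))
           (weighted-term (l₁ * l₄) (l₂ * l₃) d₁₄ (*-≢0 l₂≢0 l₃≢0)))
           (weighted-term (l₂ * l₃) (l₁ * l₄) d₂₃ (*-≢0 l₁≢0 l₄≢0)))
           (weighted-term (l₂ * l₄) (l₁ * l₃) d₂₄ (*-≢0 l₁≢0 l₃≢0)))
           (weighted-term (l₃ * l₄) (l₁ * l₂) d₃₄ (*-≢0 l₁≢0 l₂≢0)) ⟩
    - (l₁ * l₂ * d₁₂) + - (l₁ * l₃ * d₁₃) + - (l₁ * l₄ * d₁₄)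
      + - (l₂ * l₃ * d₂₃) + - (l₂ * l₄ * d₂₄) + - (l₃ * l₄ * d₃₄)
      ≡⟨ solve 6 (λ a b c d e f → :- a :+ :- b :+ :- c :+ :- d :+ :- e :+ :- f := :- (a :+ b :+ c :+ d :+ e :+ f))
           refl (l₁ * l₂ * d₁₂) (l₁ * l₃ * d₁₃) (l₁ * l₄ * d₁₄) (l₂ * l₃ * d₂₃) (l₂ * l₄ * d₂₄) (l₃ * l₄ * d₃₄) ⟩
    - (l₁ * l₂ * d₁₂ + l₁ * l₃ * d₁₃ + l₁ * l₄ * d₁₄ + l₂ * l₃ * d₂₃ + l₂ * l₄ * d₂₄ + l₃ * l₄ * d₃₄)
      ∎
    where
    w₁₂ w₁₃ w₁₄ w₂₃ w₂₄ w₃₄ : Carrier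
    w₁₂ = (- (l₃ * l₄)) ⁻¹ * d₁₂
    w₁₃ = (- (l₂ * l₄)) ⁻¹ * d₁₃
    w₁₄ = (- (l₂ * l₃)) ⁻¹ * d₁₄
    w₂₃ = (- (l₁ * l₄)) ⁻¹ * d₂₃
    w₂₄ = (- (l₁ * l₃)) ⁻¹ * d₂₄
    w₃₄ = (- (l₁ * l₂)) ⁻¹ * d₃₄

  four-point-eq-from-weights :
    ∀ {l₁ l₂ l₃ l₄ t₁₂ t₁₃ t₁₄ t₂₃ t₂₄ t₃₄ d₁₂ d₁₃ d₁₄ d₂₃ d₂₄ d₃₄} →
    l₁ ≢ 0# → l₂ ≢ 0# → l₃ ≢ 0# → l₄ ≢ 0# →
    t₁₂ ≡ - (l₃ * l₄) → t₁₃ ≡ - (l₂ * l₄) → t₁₄ ≡ - (l₂ * l₃) →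
    t₂₃ ≡ - (l₁ * l₄) → t₂₄ ≡ - (l₁ * l₃) → t₃₄ ≡ - (l₁ * l₂) →
    t₁₂ ⁻¹ * d₁₂ + t₁₃ ⁻¹ * d₁₃ + t₁₄ ⁻¹ * d₁₄ + t₂₃ ⁻¹ * d₂₃ + t₂₄ ⁻¹ * d₂₄ + t₃₄ ⁻¹ * d₃₄ ≡ 1# →
    FourPointEq l₁ l₂ l₃ l₄ d₁₂ d₁₃ d₁₄ d₂₃ d₂₄ d₃₄
  four-point-eq-from-weights {l₁} {l₂} {l₃} {l₄} {d₁₂ = d₁₂} {d₁₃} {d₁₄} {d₂₃} {d₂₄} {d₃₄}
    l₁≢0 l₂≢0 l₃≢0 l₄≢0 refl refl refl refl refl refl weighted-sum≡1 = begin
      S                                  ≡⟨ -‿involutive S ⟨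
      - - S                              ≡⟨ cong -_ (weighted-sum-scaled d₁₂ d₁₃ d₁₄ d₂₃ d₂₄ d₃₄ l₁≢0 l₂≢0 l₃≢0 l₄≢0) ⟨
      - (l₁ * l₂ * l₃ * l₄ * _)          ≡⟨ cong (λ t → - (l₁ * l₂ * l₃ * l₄ * t)) weighted-sum≡1 ⟩
      - (l₁ * l₂ * l₃ * l₄ * 1#)         ≡⟨ cong -_ (*-identityʳ _) ⟩
      - (l₁ * l₂ * l₃ * l₄)              ∎
    where
    S : Carrier
    S = l₁ * l₂ * d₁₂ + l₁ * l₃ * d₁₃ + l₁ * l₄ * d₁₄ + l₂ * l₃ * d₂₃ + l₂ * l₄ * d₂₄ + l₃ * l₄ * d₃₄

  four-point-eq-rotate :
    ∀ {l₁ l₂ l₃ l₄ l₁′ l₂′ l₃′ l₄′ d₁₂ d₁₃ d₁₄ d₂₃ d₂₄ d₃₄} →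
    l₁′ ≡ - l₂ → l₂′ ≡ - l₃ → l₃′ ≡ - l₄ → l₄′ ≡ - l₁ →
    FourPointEq l₁ l₂ l₃ l₄ d₁₂ d₁₃ d₁₄ d₂₃ d₂₄ d₃₄ →
    FourPointEq l₁′ l₂′ l₃′ l₄′ d₂₃ d₂₄ d₁₂ d₃₄ d₁₃ d₁₄
  four-point-eq-rotate {l₁} {l₂} {l₃} {l₄} {d₁₂ = d₁₂} {d₁₃} {d₁₄} {d₂₃} {d₂₄} {d₃₄} refl refl refl refl eq =
    begin
      - l₂ * - l₃ * d₂₃ + - l₂ * - l₄ * d₂₄ + - l₂ * - l₁ * d₁₂
        + - l₃ * - l₄ * d₃₄ + - l₃ * - l₁ * d₁₃ + - l₄ * - l₁ * d₁₄
        ≡⟨ solve 10 (λ l₁ l₂ l₃ l₄ d₁₂ d₁₃ d₁₄ d₂₃ d₂₄ d₃₄ →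
             :- l₂ :* :- l₃ :* d₂₃ :+ :- l₂ :* :- l₄ :* d₂₄ :+ :- l₂ :* :- l₁ :* d₁₂
               :+ :- l₃ :* :- l₄ :* d₃₄ :+ :- l₃ :* :- l₁ :* d₁₃ :+ :- l₄ :* :- l₁ :* d₁₄ :=
             l₁ :* l₂ :* d₁₂ :+ l₁ :* l₃ :* d₁₃ :+ l₁ :* l₄ :* d₁₄ :+ l₂ :* l₃ :* d₂₃ :+ l₂ :* l₄ :* d₂₄ :+ l₃ :* l₄ :* d₃₄)
             refl l₁ l₂ l₃ l₄ d₁₂ d₁₃ d₁₄ d₂₃ d₂₄ d₃₄ ⟩
      l₁ * l₂ * d₁₂ + l₁ * l₃ * d₁₃ + l₁ * l₄ * d₁₄ + l₂ * l₃ * d₂₃ + l₂ * l₄ * d₂₄ + l₃ * l₄ * d₃₄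
        ≡⟨ eq ⟩
      - (l₁ * l₂ * l₃ * l₄)
        ≡⟨ solve 4 (λ l₁ l₂ l₃ l₄ → :- (l₁ :* l₂ :* l₃ :* l₄) := :- (:- l₂ :* :- l₃ :* :- l₄ :* :- l₁)) refl l₁ l₂ l₃ l₄ ⟩
      - (- l₂ * - l₃ * - l₄ * - l₁)
        ∎

  -- Solving the four-point equation of b, u, x, v for d_uv, when d vanishes
  -- on bu, bx, bv and ux; here α = det(b,u,x), β = det(b,x,v), γ = det(b,u,v).
  four-point-eq-fan-step :
    ∀ {α β γ r l₁ d₁₂ d₁₃ d₁₄ d₂₃ d₂₄ d₃₄} → α ≢ 0# → β ≢ 0# →
    l₁ ≡ β - γ + α → d₁₂ ≡ 0# → d₁₃ ≡ 0# → d₁₄ ≡ 0# → d₂₃ ≡ 0# →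
    FourPointEq l₁ (- β) γ (- α) d₁₂ d₁₃ d₁₄ d₂₃ d₂₄ d₃₄ →
    d₃₄ ≡ - (β * (r - β)) → d₂₄ ≡ - (γ * ((α + r) - γ))
  four-point-eq-fan-step {α} {β} {γ} {r} {d₂₄ = d₂₄} {d₃₄} α≢0 β≢0 refl refl refl refl refl eq d₃₄≡ =
    x+y≡0⇒x≡-y (*-cancelˡ-≡0 (*-≢0 α≢0 β≢0) (begin
      α * β * (d₂₄ + γ * ((α + r) - γ))
        ≡⟨ solve 6 (λ α β γ r d₂₄ d₃₄ → let l₁ = β :- γ :+ α in
             α :* β :* (d₂₄ :+ γ :* ((α :+ r) :- γ)) :=
             (l₁ :* :- β :* 0̂ :+ l₁ :* γ :* 0̂ :+ l₁ :* :- α :* 0̂ :+ :- β :* γ :* 0̂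
                :+ :- β :* :- α :* d₂₄ :+ γ :* :- α :* d₃₄ :+ l₁ :* :- β :* γ :* :- α)
             :+ α :* γ :* (d₃₄ :+ β :* (r :- β))) refl α β γ r d₂₄ d₃₄ ⟩
      _ + α * γ * (d₃₄ + β * (r - β))
        ≡⟨ cong₂ (λ s t → s + α * γ * t) (x≡-y⇒x+y≡0 eq) (x≡-y⇒x+y≡0 d₃₄≡) ⟩
      0# + α * γ * 0#
        ≡⟨ solve 2 (λ α γ → 0̂ :+ α :* γ :* 0̂ := 0̂) refl α γ ⟩
      0# ∎))

module CyclicIndex (N : ℕ) where

  open import Data.Bool using (true; false; T)
  open import Data.Unit using (tt)
  open import Data.Empty using (⊥; ⊥-elim)
  open import Data.Nat using (suc; _+_; _∸_; _<_; _≤_; _<ᵇ_)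
  open import Data.Nat.Properties
    using (_<?_; +-assoc; +-comm; +-identityʳ; +-cancelʳ-<; +-mono-<; +-monoʳ-<; <-asym; <-irrefl; <-trans;
           <-≤-trans; ≤-<-trans; ≤-antisym; <⇒≤; ≮⇒≥; <ᵇ⇒<; <⇒<ᵇ; m≤m+n; m+n∸n≡m; m∸n+n≡m; ∸-monoˡ-<)
  open import Data.Nat.DivMod using (_%_; m%n<n; m<n⇒m%n≡m; [m+n]%n≡m%n; %-distribˡ-+; m%n%n≡m%n)
  open import Data.Fin using (Fin; toℕ)
  open import Data.Fin.Properties using (toℕ-fromℕ<; toℕ-injective; toℕ<n)
  open import Relation.Nullary using (yes; no)
  open import Relation.Binary.PropositionalEquality
  open ≡-Reasoning

  n : ℕ
  n = suc N

  toℕ-shift : ∀ (b : Fin n) k → toℕ (shift b k) ≡ (toℕ b + k) % n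
  toℕ-shift b k = toℕ-fromℕ< _

  private
    [m%n+k]%n≡[m+k]%n : ∀ m k → (m % n + k) % n ≡ (m + k) % n
    [m%n+k]%n≡[m+k]%n m k = begin
      (m % n + k) % n            ≡⟨ %-distribˡ-+ (m % n) k n ⟩
      (m % n % n + k % n) % n    ≡⟨ cong (λ t → (t + k % n) % n) (m%n%n≡m%n m n) ⟩
      (m % n + k % n) % n        ≡⟨ %-distribˡ-+ m k n ⟨
      (m + k) % n                ∎

  shift-zero : ∀ b → shift b 0 ≡ b
  shift-zero b = toℕ-injective (begin
    toℕ (shift b 0)  ≡⟨ toℕ-shift b 0 ⟩
    (toℕ b + 0) % n  ≡⟨ cong (_% n) (+-identityʳ (toℕ b)) ⟩
    toℕ b % n        ≡⟨ m<n⇒m%n≡m (toℕ<n b) ⟩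
    toℕ b            ∎)

  shift-n : ∀ b → shift b n ≡ b
  shift-n b = toℕ-injective (begin
    toℕ (shift b n)  ≡⟨ toℕ-shift b n ⟩
    (toℕ b + n) % n  ≡⟨ [m+n]%n≡m%n (toℕ b) n ⟩
    toℕ b % n        ≡⟨ m<n⇒m%n≡m (toℕ<n b) ⟩
    toℕ b            ∎)

  shift-shift : ∀ b r s → shift (shift b r) s ≡ shift b (r + s)
  shift-shift b r s = toℕ-injective (begin
    toℕ (shift (shift b r) s)   ≡⟨ toℕ-shift (shift b r) s ⟩
    (toℕ (shift b r) + s) % n   ≡⟨ cong (λ t → (t + s) % n) (toℕ-shift b r) ⟩
    ((toℕ b + r) % n + s) % n   ≡⟨ [m%n+k]%n≡[m+k]%n (toℕ b + r) s ⟩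
    (toℕ b + r + s) % n         ≡⟨ cong (_% n) (+-assoc (toℕ b) r s) ⟩
    (toℕ b + (r + s)) % n       ≡⟨ toℕ-shift b (r + s) ⟨
    toℕ (shift b (r + s))       ∎)

  offset : Fin n → Fin n → ℕ
  offset b u = (n ∸ toℕ b + toℕ u) % n

  offset<n : ∀ b u → offset b u < n
  offset<n b u = m%n<n (n ∸ toℕ b + toℕ u) n

  shift-offset : ∀ b u → shift b (offset b u) ≡ u
  shift-offset b u = toℕ-injective (begin
    toℕ (shift b (offset b u))          ≡⟨ toℕ-shift b (offset b u) ⟩
    (toℕ b + offset b u) % n            ≡⟨ cong (_% n) (+-comm (toℕ b) (offset b u)) ⟩
    (offset b u + toℕ b) % n            ≡⟨ [m%n+k]%n≡[m+k]%n (n ∸ toℕ b + toℕ u) (toℕ b) ⟩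
    (n ∸ toℕ b + toℕ u + toℕ b) % n     ≡⟨ cong (_% n) (+-assoc (n ∸ toℕ b) (toℕ u) (toℕ b)) ⟩
    (n ∸ toℕ b + (toℕ u + toℕ b)) % n   ≡⟨ cong (λ t → (n ∸ toℕ b + t) % n) (+-comm (toℕ u) (toℕ b)) ⟩
    (n ∸ toℕ b + (toℕ b + toℕ u)) % n   ≡⟨ cong (_% n) (+-assoc (n ∸ toℕ b) (toℕ b) (toℕ u)) ⟨
    (n ∸ toℕ b + toℕ b + toℕ u) % n     ≡⟨ cong (λ t → (t + toℕ u) % n) (m∸n+n≡m (<⇒≤ (toℕ<n b))) ⟩
    (n + toℕ u) % n                     ≡⟨ cong (_% n) (+-comm n (toℕ u)) ⟩
    (toℕ u + n) % n                     ≡⟨ [m+n]%n≡m%n (toℕ u) n ⟩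
    toℕ u % n                           ≡⟨ m<n⇒m%n≡m (toℕ<n u) ⟩
    toℕ u                               ∎)

  data ShiftView (b : Fin n) (k : ℕ) : Set where
    no-wrap : toℕ b + k < n → toℕ (shift b k) ≡ toℕ b + k → ShiftView b k
    wrap    : n ≤ toℕ b + k → toℕ (shift b k) + n ≡ toℕ b + k → ShiftView b k

  shiftView : ∀ b {k} → k < n → ShiftView b k
  shiftView b {k} k<n with toℕ b + k <? n
  ... | yes b+k<n = no-wrap b+k<n (trans (toℕ-shift b k) (m<n⇒m%n≡m b+k<n))
  ... | no b+k≮n = wrap n≤b+k (begin
      toℕ (shift b k) + n              ≡⟨ cong (_+ n) (toℕ-shift b k) ⟩
      (toℕ b + k) % n + n              ≡⟨ cong (λ t → t % n + n) (m∸n+n≡m n≤b+k) ⟨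
      (toℕ b + k ∸ n + n) % n + n      ≡⟨ cong (_+ n) ([m+n]%n≡m%n (toℕ b + k ∸ n) n) ⟩
      (toℕ b + k ∸ n) % n + n          ≡⟨ cong (_+ n) (m<n⇒m%n≡m b+k∸n<n) ⟩
      toℕ b + k ∸ n + n                ≡⟨ m∸n+n≡m n≤b+k ⟩
      toℕ b + k                        ∎)
    where
    n≤b+k : n ≤ toℕ b + k
    n≤b+k = ≮⇒≥ b+k≮n
    b+k∸n<n : toℕ b + k ∸ n < n
    b+k∸n<n = subst (toℕ b + k ∸ n <_) (m+n∸n≡m n n) (∸-monoˡ-< (+-mono-< (toℕ<n b) k<n) n≤b+k)

  module _ (b : Fin n) where

    no-wrap-< : ∀ {r s} → toℕ (shift b r) ≡ toℕ b + r → toℕ (shift b s) ≡ toℕ b + s → r < s →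
                toℕ (shift b r) < toℕ (shift b s)
    no-wrap-< er es r<s = subst₂ _<_ (sym er) (sym es) (+-monoʳ-< (toℕ b) r<s)

    wrap-< : ∀ {r s} → toℕ (shift b r) + n ≡ toℕ b + r → toℕ (shift b s) + n ≡ toℕ b + s → r < s →
             toℕ (shift b r) < toℕ (shift b s)
    wrap-< er es r<s = +-cancelʳ-< n _ _ (subst₂ _<_ (sym er) (sym es) (+-monoʳ-< (toℕ b) r<s))

    wrap<base : ∀ {k} → toℕ (shift b k) + n ≡ toℕ b + k → k < n → toℕ (shift b k) < toℕ b
    wrap<base ek k<n = +-cancelʳ-< n _ _ (subst (_< toℕ b + n) (sym ek) (+-monoʳ-< (toℕ b) k<n))

    base≤no-wrap : ∀ {k} → toℕ (shift b k) ≡ toℕ b + k → toℕ b ≤ toℕ (shift b k)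
    base≤no-wrap {k} ek = subst (toℕ b ≤_) (sym ek) (m≤m+n (toℕ b) k)

    base<no-wrap : ∀ {k} → toℕ (shift b k) ≡ toℕ b + k → 0 < k → toℕ b < toℕ (shift b k)
    base<no-wrap {k} ek 0<k =
      subst₂ _<_ (+-identityʳ (toℕ b)) (sym ek) (+-monoʳ-< (toℕ b) 0<k)

    no-wrap-after-wrap : ∀ {r s} → n ≤ toℕ b + r → toℕ b + s < n → r < s → ⊥
    no-wrap-after-wrap n≤b+r b+s<n r<s =
      <-irrefl refl (<-trans (≤-<-trans n≤b+r (+-monoʳ-< (toℕ b) r<s)) b+s<n)

    shift-<-≢ : ∀ {r s} → r < s → s < n → shift b r ≢ shift b s
    shift-<-≢ r<s s<n eq with shiftView b (<-trans r<s s<n) | shiftView b s<n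
    ... | no-wrap _ er  | no-wrap _ es  = <-irrefl (cong toℕ eq) (no-wrap-< er es r<s)
    ... | wrap _ er     | wrap _ es     = <-irrefl (cong toℕ eq) (wrap-< er es r<s)
    ... | no-wrap _ er  | wrap _ es     =
      <-irrefl (cong toℕ (sym eq)) (<-≤-trans (wrap<base es s<n) (base≤no-wrap er))
    ... | wrap n≤b+r _  | no-wrap b+s<n _ = no-wrap-after-wrap n≤b+r b+s<n r<s

  ord-sym : ∀ {A : Set} (f : Fin n → Fin n → A) i j → ord f i j ≡ ord f j i
  ord-sym f i j with toℕ i <ᵇ toℕ j in i<ᵇj | toℕ j <ᵇ toℕ i in j<ᵇi
  ... | true  | false = refl
  ... | false | true  = refl
  ... | true  | true  =
    ⊥-elim (<-asym (<ᵇ⇒< (toℕ i) (toℕ j) (subst T (sym i<ᵇj) tt)) (<ᵇ⇒< (toℕ j) (toℕ i) (subst T (sym j<ᵇi) tt)))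
  ... | false | false = cong₂ f (sym i≡j) i≡j
    where
    i≡j : i ≡ j
    i≡j = toℕ-injective (≤-antisym (≮⇒≥ (λ j<i → subst T j<ᵇi (<⇒<ᵇ j<i)))
                                   (≮⇒≥ (λ i<j → subst T i<ᵇj (<⇒<ᵇ i<j))))

module ConvexPosition (F : OrderedField) (N : ℕ) (p : Fin (suc N) → Geometry.Point F)
                      (convex : Geometry.Config.ConvexCCW F p) where

  open import Data.Nat using (zero; _+_; _∸_; _<_; z≤n; s≤s)
  open import Data.Nat.Properties
    using (+-comm; <-trans; ≤-<-trans; ≤-trans; m≤n+m; m∸n≤m; m+[n∸m]≡n; m<n⇒0<n∸m; ∸-monoˡ-<; <⇒≤; n<1+n)
  open import Relation.Binary.PropositionalEquality

  open OrderedField F using (0#; *-pos) renaming (_<_ to _<ᶠ_)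
  open Geometry.Config F p using (Δ)
  open OrderedFieldProperties F
  open DeterminantProperties F
  open CyclicIndex N

  module _ (i : Fin n) where

    private
      i≢shift : ∀ {r} → 0 < r → r < n → i ≢ shift i r
      i≢shift 0<r r<n eq = shift-<-≢ i 0<r r<n (trans (shift-zero i) eq)

    ccw-consecutive : ∀ {r} → 0 < r → suc r < n → 0# <ᶠ Δ i (shift i r) (shift i (suc r))
    ccw-consecutive {r} 0<r r+1<n =
      subst (0# <ᶠ_) (sym (det-cyclic (p i) (p (shift i r)) (p (shift i (suc r))))) 0<Δ
      where
      next-shift : next (shift i r) ≡ shift i (suc r)
      next-shift = trans (shift-shift i r 1) (cong (shift i) (+-comm r 1))
      0<Δ : 0# <ᶠ Δ (shift i r) (shift i (suc r)) i
      0<Δ = subst (λ v → 0# <ᶠ Δ (shift i r) v i) next-shift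
              (convex (shift i r) i (i≢shift 0<r (<-trans (n<1+n r) r+1<n))
                      (λ eq → i≢shift (s≤s z≤n) r+1<n (trans eq next-shift)))

    ccw-first : ∀ {s} → 1 < s → s < n → 0# <ᶠ Δ i (shift i 1) (shift i s)
    ccw-first 1<s s<n =
      convex i _ (λ eq → i≢shift (<-trans (s≤s z≤n) 1<s) s<n (sym eq))
                 (λ eq → shift-<-≢ i 1<s s<n (sym eq))

    -- With h = i + 1 and w = v + 1, the Grassmann–Plücker relation
    -- det(i,h,v) det(i,u,w) = det(i,h,u) det(i,v,w) + det(i,h,w) det(i,u,v)
    -- leaves det(i,u,w) as the only factor not known to be positive.
    ccw-gap : ∀ r g → 0 < r → suc (g + r) < n → 0# <ᶠ Δ i (shift i r) (shift i (suc (g + r)))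
    ccw-gap r zero 0<r lt = ccw-consecutive 0<r lt
    ccw-gap 1 (suc g) _ lt = ccw-first (s≤s (s≤s z≤n)) lt
    ccw-gap (suc (suc r)) (suc g) 0<r lt =
      *-pos⇒posʳ (ccw-first (s≤s (≤-trans (s≤s z≤n) (m≤n+m (suc (suc r)) g))) lt′)
        (subst (0# <ᶠ_) (sym (det-plücker (p i) (p h) (p v) (p u) (p w)))
          (+-pos (*-pos (ccw-first (s≤s (s≤s z≤n)) (<-trans (s≤s (m≤n+m (suc (suc r)) g)) lt′))
                        (ccw-consecutive (s≤s z≤n) lt))
                 (*-pos (ccw-first (s≤s (s≤s z≤n)) lt)
                        (ccw-gap (suc (suc r)) g 0<r lt′))))
      where
      h u v w : Fin n
      h = shift i 1
      u = shift i (suc (suc r))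
      v = shift i (suc (g + suc (suc r)))
      w = shift i (suc (suc g + suc (suc r)))
      lt′ : suc (g + suc (suc r)) < n
      lt′ = <-trans (n<1+n _) lt

    ccw-offsets : ∀ {r s} → 0 < r → r < s → s < n → 0# <ᶠ Δ i (shift i r) (shift i s)
    ccw-offsets {r} {s} 0<r r<s s<n =
      subst (λ t → 0# <ᶠ Δ i (shift i r) (shift i t)) s≡ (ccw-gap r (s ∸ suc r) 0<r (subst (_< n) (sym s≡) s<n))
      where
      s≡ : suc (s ∸ suc r + r) ≡ s
      s≡ = trans (cong suc (+-comm (s ∸ suc r) r)) (m+[n∸m]≡n r<s)

  module _ (b : Fin n) {k₁ k₂ k₃} (k₁<k₂ : k₁ < k₂) (k₂<k₃ : k₂ < k₃) (k₃<n : k₃ < n) where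

    ccw₁₂₃ : 0# <ᶠ Δ (shift b k₁) (shift b k₂) (shift b k₃)
    ccw₁₂₃ = subst₂ (λ u v → 0# <ᶠ Δ (shift b k₁) u v) (from-k₁ k₁<k₂) (from-k₁ (<-trans k₁<k₂ k₂<k₃))
      (ccw-offsets (shift b k₁) (m<n⇒0<n∸m k₁<k₂) (∸-monoˡ-< k₂<k₃ (<⇒≤ k₁<k₂)) (≤-<-trans (m∸n≤m k₃ k₁) k₃<n))
      where
      from-k₁ : ∀ {k} → k₁ < k → shift (shift b k₁) (k ∸ k₁) ≡ shift b k
      from-k₁ {k} k₁<k = trans (shift-shift b k₁ (k ∸ k₁)) (cong (shift b) (m+[n∸m]≡n (<⇒≤ k₁<k)))

    ccw₂₃₁ : 0# <ᶠ Δ (shift b k₂) (shift b k₃) (shift b k₁)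
    ccw₂₃₁ = subst (0# <ᶠ_) (det-cyclic (p (shift b k₁)) (p (shift b k₂)) (p (shift b k₃))) ccw₁₂₃

    cw₁₃₂ : Δ (shift b k₁) (shift b k₃) (shift b k₂) <ᶠ 0#
    cw₁₃₂ = subst (_<ᶠ 0#) (sym (det-swap (p (shift b k₁)) (p (shift b k₂)) (p (shift b k₃)))) (pos⇒neg-neg ccw₁₂₃)

module TriangulationProperties (F : OrderedField) (M : ℕ) (p : Fin (suc (suc M)) → Geometry.Point F)
  (convex : Geometry.Config.ConvexCCW F p) (E : Fin (suc (suc M)) → Fin (suc (suc M)) → Bool)
  (triangulation : Geometry.Config.Triangulation F p E) where

  open import Data.Bool using (true; false; T)
  open import Data.Unit using (tt)
  open import Data.Empty using (⊥-elim)
  open import Data.Product using (_×_; _,_; proj₁; proj₂)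
  open import Data.Sum using (_⊎_; inj₁; inj₂)
  open import Data.Nat using (_<_; z≤n; s≤s; _≡ᵇ_)
  open import Data.Nat.Properties using (<-cmp; <-trans; ≡ᵇ⇒≡; ≡⇒≡ᵇ)
  open import Data.Fin using (toℕ; _≟_)
  open import Data.Fin.Properties using (toℕ-injective)
  open import Relation.Nullary using (¬_; yes; no; contradiction)
  open import Relation.Binary.Definitions using (tri<; tri≈; tri>)
  open import Relation.Binary.Structures using (IsStrictTotalOrder)
  open import Relation.Binary.PropositionalEquality

  open OrderedField F using (0#; isStrictTotalOrder) renaming (_<_ to _<ᶠ_)
  open IsStrictTotalOrder isStrictTotalOrder using (irrefl; asym)
  open Geometry.Config F p using (Δ; Adj; adjᵇ; Cross)
  open OrderedFieldProperties F
  open DeterminantProperties F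
  open CyclicIndex (suc M)
  open ConvexPosition F (suc M) p convex

  adj-sym : ∀ {i j} → Adj E i j → Adj E j i
  adj-sym {i} {j} (i≢j , eq) = (λ j≡i → i≢j (sym j≡i)) , trans (ord-sym E j i) eq

  adj⇒adjᵇ : ∀ {i j} → Adj E i j → T (adjᵇ E i j)
  adj⇒adjᵇ {i} {j} (i≢j , eq) rewrite eq with toℕ i ≡ᵇ toℕ j in i≡ᵇj
  ... | false = tt
  ... | true  = i≢j (toℕ-injective (≡ᵇ⇒≡ (toℕ i) (toℕ j) (subst T (sym i≡ᵇj) tt)))

  adjᵇ⇒adj : ∀ {i j} → T (adjᵇ E i j) → Adj E i j
  adjᵇ⇒adj {i} {j} t with ord E i j | toℕ i ≡ᵇ toℕ j in i≡ᵇj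
  ... | true  | false = (λ i≡j → subst T i≡ᵇj (≡⇒≡ᵇ (toℕ i) (toℕ j) (cong toℕ i≡j))) , refl
  ... | true  | true  = ⊥-elim t
  ... | false | _     = ⊥-elim t

  adj-if-uncrossed : ∀ {a b} → a ≢ b → (∀ c e → Adj E c e → ¬ Cross a b c e) → Adj E a b
  adj-if-uncrossed {a} {b} a≢b uncrossed with ord E a b in eq
  ... | true  = a≢b , refl
  ... | false =
    let c , e , adj , cross = proj₂ triangulation a b a≢b (λ (_ , eq′) → contradiction (trans (sym eq) eq′) λ ())
    in ⊥-elim (uncrossed c e adj cross)

  hull-edge : ∀ i → Adj E i (next i)
  hull-edge i = adj-if-uncrossed i≢next uncrossed
    where
    i≢next : i ≢ next i
    i≢next eq = shift-<-≢ i (s≤s z≤n) (s≤s (s≤s z≤n)) (trans (shift-zero i) eq)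
    ¬neg : ∀ k → ¬ (Δ i (next i) k <ᶠ 0#)
    ¬neg k with k ≟ i | k ≟ next i
    ... | yes refl | _        = irrefl (det-repeat₁₃ (p i) (p (next i)))
    ... | no _     | yes refl = irrefl (det-repeat₂₃ (p i) (p (next i)))
    ... | no k≢i   | no k≢i+1 = asym (convex i k k≢i k≢i+1)
    uncrossed : ∀ c e → Adj E c e → ¬ Cross i (next i) c e
    uncrossed c e _ (cross , _) with *-neg⇒opposite-signs cross
    ... | inj₁ (neg , _) = ¬neg c neg
    ... | inj₂ (_ , neg) = ¬neg e neg

  module _ (b : Fin n) where

    private
      P : ℕ → Fin n
      P = shift b

    interleaved-cross : ∀ {x y z w} → x < y → y < z → z < w → w < n → Cross (P x) (P z) (P y) (P w)
    interleaved-cross x<y y<z z<w w<n =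
      neg*pos⇒neg (cw₁₃₂ b x<y y<z (<-trans z<w w<n)) (ccw₁₂₃ b (<-trans x<y y<z) z<w w<n) ,
      pos*neg⇒neg (ccw₂₃₁ b x<y (<-trans y<z z<w) w<n) (cw₁₃₂ b y<z z<w w<n)

    module _ {r r′} (r<r′ : r < r′) (r′<n : r′ < n) where

      chord-inside : ∀ {s} → s < n → Δ (P r) (P r′) (P s) <ᶠ 0# → r < s × s < r′
      chord-inside {s} s<n neg with <-cmp s r | <-cmp s r′
      ... | tri< s<r _ _  | _             = ⊥-elim (asym (ccw₂₃₁ b s<r r<r′ r′<n) neg)
      ... | tri≈ _ refl _ | _             = ⊥-elim (irrefl (det-repeat₁₃ (p (P r)) (p (P r′))) neg)
      ... | tri> _ _ r<s  | tri< s<r′ _ _ = r<s , s<r′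
      ... | tri> _ _ _    | tri≈ _ refl _ = ⊥-elim (irrefl (det-repeat₂₃ (p (P r)) (p (P r′))) neg)
      ... | tri> _ _ _    | tri> _ _ r′<s = ⊥-elim (asym (ccw₁₂₃ b r<r′ r′<s s<n) neg)

      chord-outside : ∀ {s} → 0# <ᶠ Δ (P r) (P r′) (P s) → s < r ⊎ r′ < s
      chord-outside {s} pos with <-cmp s r | <-cmp s r′
      ... | tri< s<r _ _  | _             = inj₁ s<r
      ... | tri≈ _ refl _ | _             = ⊥-elim (irrefl (sym (det-repeat₁₃ (p (P r)) (p (P r′)))) pos)
      ... | tri> _ _ r<s  | tri< s<r′ _ _ = ⊥-elim (asym (cw₁₃₂ b r<s s<r′ r′<n) pos)
      ... | tri> _ _ _    | tri≈ _ refl _ = ⊥-elim (irrefl (sym (det-repeat₂₃ (p (P r)) (p (P r′)))) pos)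
      ... | tri> _ _ _    | tri> _ _ r′<s = inj₂ r′<s

      -- An edge crossing P r P r′ has one endpoint strictly between r and r′
      -- and the other outside; it is then either incident to b = P 0, or it
      -- crosses b P r or b P r′.
      consecutive-neighbours-adjacent :
        0 < r → Adj E b (P r) → Adj E b (P r′) → (∀ t → r < t → t < r′ → ¬ Adj E b (P t)) →
        Adj E (P r) (P r′)
      consecutive-neighbours-adjacent 0<r b~r b~r′ none-between =
        adj-if-uncrossed (shift-<-≢ b r<r′ r′<n) λ c e →
          subst₂ (λ c e → Adj E c e → ¬ Cross (P r) (P r′) c e) (shift-offset b c) (shift-offset b e)
            (uncrossed (offset<n b c) (offset<n b e))
        where
        P0~ : ∀ {k} → Adj E b (P k) → Adj E (P 0) (P k)
        P0~ {k} = subst (λ v → Adj E v (P k)) (sym (shift-zero b))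
        leaves : ∀ {s t} → r < s → s < r′ → t < r ⊎ r′ < t → t < n → ¬ Adj E (P s) (P t)
        leaves {s} {0} r<s s<r′ _ _ s~0 =
          none-between s r<s s<r′ (subst (λ v → Adj E v (P s)) (shift-zero b) (adj-sym s~0))
        leaves {s} {suc t} r<s s<r′ (inj₁ t<r) _ s~t =
          proj₁ triangulation (P 0) (P r) (P (suc t)) (P s) (P0~ b~r) (adj-sym s~t)
            (interleaved-cross (s≤s z≤n) t<r r<s (<-trans s<r′ r′<n))
        leaves {s} {suc t} r<s s<r′ (inj₂ r′<t) t<n s~t =
          proj₁ triangulation (P 0) (P r′) (P s) (P (suc t)) (P0~ b~r′) s~t
            (interleaved-cross (<-trans 0<r r<s) s<r′ r′<t t<n)
        uncrossed : ∀ {s t} → s < n → t < n → Adj E (P s) (P t) → ¬ Cross (P r) (P r′) (P s) (P t)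
        uncrossed s<n t<n s~t (cross , _) with *-neg⇒opposite-signs cross
        ... | inj₁ (neg , pos) = let r<s , s<r′ = chord-inside s<n neg in
                                 leaves r<s s<r′ (chord-outside pos) t<n s~t
        ... | inj₂ (pos , neg) = let r<t , t<r′ = chord-inside t<n neg in
                                 leaves r<t t<r′ (chord-outside pos) s<n (adj-sym s~t)

module FourPointRelation (F : OrderedField) (N : ℕ) (p : Fin (suc N) → Geometry.Point F)
  (general : Geometry.Config.GeneralPosition F p) (d : Fin (suc N) → Fin (suc N) → OrderedField.Carrier F)
  (inQ : Geometry.Config.InQ F p d) where

  open import Data.Empty using (⊥-elim)
  open import Data.Product using (proj₁)
  open import Data.Nat using (_<_)
  open import Data.Nat.Properties using (<-trans; <-irrefl)
  open import Data.Fin using (toℕ)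
  open import Relation.Binary.PropositionalEquality

  open OrderedField F hiding (_<_)
  open Geometry.Config F p using (Δ)
  open OrderedFieldProperties F
  open DeterminantProperties F
  open FourPointEquation F
  open CommutativeRingSolver isCommutativeRing using (solve; _:=_; _:*_; :-_)
  open CyclicIndex N

  D : Fin n → Fin n → Carrier
  D = ord d

  -- (det(b,c,e), -det(a,c,e), det(a,b,e), -det(a,b,c)) is the affine
  -- dependence of p_a, p_b, p_c, p_e.
  FourPoint : Fin n → Fin n → Fin n → Fin n → Set
  FourPoint a b c e =
    FourPointEq (Δ b c e) (- Δ a c e) (Δ a b e) (- Δ a b c) (D a b) (D a c) (D a e) (D b c) (D b e) (D c e)

  four-point-sorted : ∀ {a b c e} → toℕ a < toℕ b → toℕ b < toℕ c → toℕ c < toℕ e → FourPoint a b c e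
  four-point-sorted {a} {b} {c} {e} a<b b<c c<e =
    four-point-eq-from-weights
      (general b c e b≢c c≢e b≢e) (-‿≢0 (general a c e a≢c c≢e a≢e))
      (general a b e a≢b b≢e a≢e) (-‿≢0 (general a b c a≢b b≢c a≢c))
      (x*y≡-[y*-x] (Δ a b c) (Δ a b e))
      (trans (cong (_* Δ a c e) (det-swap (p a) (p b) (p c))) (-x*z≡-[-z*-x] (Δ a b c) (Δ a c e)))
      (trans (cong₂ _*_ (det-swap (p a) (p b) (p e)) (det-swap (p a) (p c) (p e)))
             (-y*-z≡-[-z*y] (Δ a b e) (Δ a c e)))
      (trans (cong (_* Δ b c e) (sym (det-cyclic (p a) (p b) (p c)))) (x*y≡-[y*-x] (Δ a b c) (Δ b c e)))
      (trans (cong₂ _*_ (sym (det-cyclic (p a) (p b) (p e))) (det-swap (p b) (p c) (p e)))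
             (y*-v≡-[v*y] (Δ a b e) (Δ b c e)))
      (trans (cong₂ _*_ (sym (det-cyclic (p a) (p c) (p e))) (sym (det-cyclic (p b) (p c) (p e))))
             (x*y≡-[y*-x] (Δ a c e) (Δ b c e)))
      (proj₁ inQ a b c e a<b b<c c<e)
    where
    <⇒≢ : ∀ {x y : Fin n} → toℕ x < toℕ y → x ≢ y
    <⇒≢ x<y refl = <-irrefl refl x<y
    a≢b : a ≢ b
    a≢b = <⇒≢ a<b
    b≢c : b ≢ c
    b≢c = <⇒≢ b<c
    c≢e : c ≢ e
    c≢e = <⇒≢ c<e
    a≢c : a ≢ c
    a≢c = <⇒≢ (<-trans a<b b<c)
    b≢e : b ≢ e
    b≢e = <⇒≢ (<-trans b<c c<e)
    a≢e : a ≢ e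
    a≢e = <⇒≢ (<-trans a<b (<-trans b<c c<e))
    x*y≡-[y*-x] : ∀ x y → x * y ≡ - (y * - x)
    x*y≡-[y*-x] = solve 2 (λ x y → x :* y := :- (y :* :- x)) refl
    -x*z≡-[-z*-x] : ∀ x z → - x * z ≡ - (- z * - x)
    -x*z≡-[-z*-x] = solve 2 (λ x z → :- x :* z := :- (:- z :* :- x)) refl
    -y*-z≡-[-z*y] : ∀ y z → - y * - z ≡ - (- z * y)
    -y*-z≡-[-z*y] = solve 2 (λ y z → :- y :* :- z := :- (:- z :* y)) refl
    y*-v≡-[v*y] : ∀ y v → y * - v ≡ - (v * y)
    y*-v≡-[v*y] = solve 2 (λ y v → y :* :- v := :- (v :* y)) refl

  four-point-rotate : ∀ a b c e → FourPoint a b c e → FourPoint b c e a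
  four-point-rotate a b c e four-point rewrite ord-sym d b a | ord-sym d c a | ord-sym d e a =
    four-point-eq-rotate
      (trans (sym (det-cyclic (p a) (p c) (p e))) (sym (-‿involutive (Δ a c e))))
      (cong -_ (sym (det-cyclic (p a) (p b) (p e))))
      (trans (sym (det-cyclic (p a) (p b) (p c))) (sym (-‿involutive (Δ a b c))))
      refl
      four-point

  module _ (b : Fin n) where

    private
      P : ℕ → Fin n
      P = shift b

    -- Up to a rotation, the four points are in increasing index order; the
    -- rotation depends on which of the offsets wrap around past index n - 1.
    four-point-cyclic : ∀ {s t u} → 0 < s → s < t → t < u → u < n → FourPoint b (P s) (P t) (P u)
    four-point-cyclic {s} {t} {u} 0<s s<t t<u u<n
      with shiftView b (<-trans s<t (<-trans t<u u<n)) | shiftView b (<-trans t<u u<n) | shiftView b u<n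
    ... | no-wrap _ es | no-wrap _ et | no-wrap _ eu =
      four-point-sorted (base<no-wrap b es 0<s) (no-wrap-< b es et s<t) (no-wrap-< b et eu t<u)
    ... | no-wrap _ es | no-wrap _ et | wrap _ eu =
      four-point-rotate (P u) b (P s) (P t)
        (four-point-sorted (wrap<base b eu u<n) (base<no-wrap b es 0<s) (no-wrap-< b es et s<t))
    ... | no-wrap _ es | wrap _ et | wrap _ eu =
      four-point-rotate (P u) b (P s) (P t) (four-point-rotate (P t) (P u) b (P s)
        (four-point-sorted (wrap-< b et eu t<u) (wrap<base b eu u<n) (base<no-wrap b es 0<s)))
    ... | wrap _ es | wrap _ et | wrap _ eu =
      four-point-rotate (P u) b (P s) (P t) (four-point-rotate (P t) (P u) b (P s)
        (four-point-rotate (P s) (P t) (P u) b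
          (four-point-sorted (wrap-< b es et s<t) (wrap-< b et eu t<u) (wrap<base b eu u<n))))
    ... | wrap n≤b+s _ | no-wrap b+t<n _ | _ = ⊥-elim (no-wrap-after-wrap b n≤b+s b+t<n s<t)
    ... | _ | wrap n≤b+t _ | no-wrap b+u<n _ = ⊥-elim (no-wrap-after-wrap b n≤b+t b+u<n t<u)

module Fan (F : OrderedField) (m : ℕ) (p : Fin (suc (suc (suc m))) → Geometry.Point F)
  (general : Geometry.Config.GeneralPosition F p) (convex : Geometry.Config.ConvexCCW F p)
  (E : Fin (suc (suc (suc m))) → Fin (suc (suc (suc m))) → Bool)
  (triangulation : Geometry.Config.Triangulation F p E)
  (d : Fin (suc (suc (suc m))) → Fin (suc (suc (suc m))) → OrderedField.Carrier F)
  (inQ : Geometry.Config.InQ F p d)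
  (d-edges : ∀ i j → Geometry.Config.Adj F p E i j → ord d i j ≡ OrderedField.0# F)
  (b : Fin (suc (suc (suc m)))) where

  open import Function using (_∘_)
  open import Data.Bool using (T)
  open import Data.Empty using (⊥-elim)
  open import Data.Sum using (inj₁; inj₂)
  open import Data.List using (_∷_; filter; applyUpTo)
  open import Data.List.Properties using (filter-accept; filter-reject; map-applyUpTo)
  open import Data.Nat as ℕ using (zero; _<_; _≤_; z≤n; s≤s; s≤s⁻¹)
  open import Data.Nat.Properties
    using (<-trans; <-irrefl; n<1+n; +-suc; +-comm; m≤n+m; suc-injective; m<1+n⇒m<n∨m≡n; <-≤-trans)
  open import Relation.Nullary using (¬_; Dec; yes; no)
  open import Relation.Nullary.Decidable using (T?)
  open import Relation.Binary.PropositionalEquality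

  open OrderedField F hiding (_<_; _≤_)
  open Geometry.Config F p using (Δ; Adj; adjᵇ; consecutiveSum; neighbours; Area)
  open DeterminantProperties F
  open FourPointEquation F
  open CommutativeRingSolver isCommutativeRing using (solve; _:=_; _:*_; _:+_; _:-_; :-_; 0̂)
  open CyclicIndex (suc (suc m))
  open TriangulationProperties F (suc m) p convex E triangulation
  open FourPointRelation F (suc (suc m)) p general d inQ

  N : ℕ
  N = suc (suc m)

  P : ℕ → Fin n
  P = shift b

  a : Fin n
  a = P N

  adj? : ∀ j → Dec (T (adjᵇ E b j))
  adj? j = T? (adjᵇ E b j)

  -- The claim for the part of the fan of b from P k to a, R being its area.
  FanFormula : ℕ → Carrier → Set
  FanFormula k R = D (P k) a ≡ - (Δ b (P k) a * (R - Δ b (P k) a))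

  b≢P : ∀ {k} → 0 < k → k < n → b ≢ P k
  b≢P 0<k k<n eq = shift-<-≢ b 0<k k<n (trans (shift-zero b) eq)

  b~a : Adj E b a
  b~a = adj-sym (subst (Adj E a) next-a (hull-edge a))
    where
    next-a : next a ≡ b
    next-a = trans (shift-shift b N 1) (trans (cong (shift b) (+-comm N 1)) (shift-n b))

  fan-step : ∀ {k l r} → 0 < k → k < l → l < N →
             Adj E b (P k) → Adj E b (P l) → Adj E (P k) (P l) →
             FanFormula l r → FanFormula k (Δ b (P k) (P l) + r)
  fan-step {k} {l} 0<k k<l l<N b~k b~l k~l =
    four-point-eq-fan-step
      (general b (P k) (P l) (b≢P 0<k k<n) (shift-<-≢ b k<l l<n) (b≢P 0<l l<n))
      (general b (P l) a (b≢P 0<l l<n) (shift-<-≢ b l<N N<n) (b≢P (s≤s z≤n) N<n))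
      (det-expand (p b) (p (P k)) (p (P l)) (p a))
      (d-edges _ _ b~k) (d-edges _ _ b~l) (d-edges _ _ b~a) (d-edges _ _ k~l)
      (four-point-cyclic b 0<k k<l l<N N<n)
    where
    N<n : N < n
    N<n = n<1+n N
    l<n : l < n
    l<n = <-trans l<N N<n
    k<n : k < n
    k<n = <-trans k<l l<n
    0<l : 0 < l
    0<l = <-trans 0<k k<l

  fan-last : ∀ {k} → Adj E (P k) a → FanFormula k (Δ b (P k) a + 0#)
  fan-last {k} k~a =
    trans (d-edges _ _ k~a) (solve 1 (λ γ → 0̂ := :- (γ :* ((γ :+ 0̂) :- γ))) refl (Δ b (P k) a))

  extend-gap : ∀ {k l} → (∀ j → k < j → j < l → ¬ Adj E b (P j)) → ¬ Adj E b (P l) →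
               ∀ j → k < j → j < suc l → ¬ Adj E b (P j)
  extend-gap gap ¬b~l j k<j j<1+l with m<1+n⇒m<n∨m≡n j<1+l
  ... | inj₁ j<l  = gap j k<j j<l
  ... | inj₂ refl = ¬b~l

  fan-formula-cong : ∀ {k xs ys} → xs ≡ ys →
                     FanFormula k (consecutiveSum b (P k ∷ ys)) → FanFormula k (consecutiveSum b (P k ∷ xs))
  fan-formula-cong {k} xs≡ys = subst (λ zs → FanFormula k (consecutiveSum b (P k ∷ zs))) (sym xs≡ys)

  offsets-tail : ∀ {f : ℕ → Fin n} {l} → (∀ i → f i ≡ P (i ℕ.+ l)) → ∀ i → f (suc i) ≡ P (i ℕ.+ suc l)
  offsets-tail {l = l} f≡ i = trans (f≡ (suc i)) (cong P (sym (+-suc i l)))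

  not-last : ∀ {len l} → suc (suc len) ℕ.+ l ≡ n → l < N
  not-last {len} {l} len+l≡n = s≤s (subst (l ≤_) (suc-injective (suc-injective len+l≡n)) (m≤n+m l len))

  -- P k is the last neighbour of b found so far and f enumerates the offsets
  -- l, l + 1, …, n - 1 still to be scanned.
  fan-walk : ∀ len (f : ℕ → Fin n) {k l} → (∀ i → f i ≡ P (i ℕ.+ l)) → len ℕ.+ l ≡ n →
             0 < k → k < l → k < N → Adj E b (P k) → (∀ j → k < j → j < l → ¬ Adj E b (P j)) →
             FanFormula k (consecutiveSum b (P k ∷ filter adj? (applyUpTo f len)))

  fan-accept : ∀ len (f : ℕ → Fin n) {k l} → (∀ i → f i ≡ P (i ℕ.+ suc l)) → suc len ℕ.+ l ≡ n →
               0 < k → k < l → Adj E b (P k) → Adj E b (P l) → Adj E (P k) (P l) →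
               FanFormula k (consecutiveSum b (P k ∷ P l ∷ filter adj? (applyUpTo f len)))
  fan-accept zero f {k} _ refl 0<k k<l b~k b~l k~l = fan-last k~l
  fan-accept (suc len) f {k} {l} f≡ len+l≡n 0<k k<l b~k b~l k~l =
    fan-step 0<k k<l (not-last len+l≡n) b~k b~l k~l
      (fan-walk (suc len) f f≡ (trans (+-suc (suc len) l) len+l≡n) (<-trans 0<k k<l) (n<1+n l) (not-last len+l≡n) b~l
        (λ j l<j j<l+1 → ⊥-elim (<-irrefl refl (<-≤-trans l<j (s≤s⁻¹ j<l+1)))))

  fan-walk zero f _ refl 0<k k<l k<N b~k gap = ⊥-elim (gap N k<N (n<1+n N) b~a)
  fan-walk (suc len) f {k} {l} f≡ len+l≡n 0<k k<l k<N b~k gap with adj? (P l)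
  ... | yes b~l =
    fan-formula-cong (trans (cong (λ v → filter adj? (v ∷ applyUpTo (f ∘ suc) len)) (f≡ 0)) (filter-accept adj? b~l))
      (fan-accept len (f ∘ suc) (offsets-tail f≡) len+l≡n 0<k k<l b~k (adjᵇ⇒adj b~l)
        (consecutive-neighbours-adjacent b k<l l<n 0<k b~k (adjᵇ⇒adj b~l) gap))
    where
    l<n : l < n
    l<n = subst (l <_) len+l≡n (s≤s (m≤n+m l len))
  ... | no ¬b~l =
    fan-formula-cong (trans (cong (λ v → filter adj? (v ∷ applyUpTo (f ∘ suc) len)) (f≡ 0)) (filter-reject adj? ¬b~l))
      (fan-walk len (f ∘ suc) (offsets-tail f≡) (trans (+-suc len l) len+l≡n)
        0<k (<-trans k<l (n<1+n l)) k<N b~k (extend-gap gap (λ b~l → ¬b~l (adj⇒adjᵇ b~l))))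

  fan-formula : FanFormula 1 (Area E b)
  fan-formula = subst (λ xs → FanFormula 1 (consecutiveSum b xs)) (sym neighbours≡)
    (fan-walk (suc m) (λ i → P (suc (suc i))) (λ i → cong P (+-comm 2 i)) (cong suc (+-comm m 2))
      (s≤s z≤n) (s≤s (s≤s z≤n)) (s≤s (s≤s z≤n)) b~c (λ j 1<j j<2 → ⊥-elim (<-irrefl refl (<-≤-trans 1<j (s≤s⁻¹ j<2)))))
    where
    b~c : Adj E b (P 1)
    b~c = hull-edge b
    neighbours≡ : neighbours E b ≡ P 1 ∷ filter adj? (applyUpTo (λ i → P (suc (suc i))) (suc m))
    neighbours≡ = trans (filter-accept adj? (adj⇒adjᵇ b~c))
                        (cong (λ xs → P 1 ∷ filter adj? xs) (map-applyUpTo suc (λ k → shift b (suc k)) (suc m)))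

lemma5p4 : (n : ℕ) → 3 ≤ n → (F : OrderedField) →
    let open OrderedField F in let open Geometry F in
    (p : Fin n → Point) →
    Config.GeneralPosition p → Config.ConvexCCW p →
    (E : Fin n → Fin n → Bool) → Config.Triangulation p E →
    (d : Fin n → Fin n → Carrier) → Config.InQ p d →
    (∀ i j → Config.Adj p E i j → ord d i j ≡ 0#) →
    ∀ i → ord d (prev i) (next i)
      ≡ - (Config.Δ p (prev i) i (next i)
           * (Config.Area p E i - Config.Δ p (prev i) i (next i)))
lemma5p4 (suc (suc (suc m))) _ F p general convex E triangulation d inQ d-edges i = begin
  ord d (prev i) (next i)                        ≡⟨ ord-sym d (prev i) (next i) ⟩
  ord d (next i) (prev i)                        ≡⟨ fan-formula ⟩
  - (Δ i (next i) (prev i) * (Area E i - Δ i (next i) (prev i)))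
    ≡⟨ cong (λ t → - (t * (Area E i - t))) (sym (det-cyclic (p (prev i)) (p i) (p (next i)))) ⟩
  - (Δ (prev i) i (next i) * (Area E i - Δ (prev i) i (next i)))  ∎
  where
  open OrderedField F
  open Geometry.Config F p using (Δ; Area)
  open DeterminantProperties F using (det-cyclic)
  open CyclicIndex (suc (suc m)) using (ord-sym)
  open Fan F m p general convex E triangulation d inQ d-edges i using (fan-formula)
  open ≡-Reasoning
lemma5p4 (suc zero) (s≤s ())
lemma5p4 (suc (suc zero)) (s≤s (s≤s ()))
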